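{- Let $V$ be a set of $n$ elements and $\ell\ge 0$. Suppose there is an algorithm which, given $V$ and an error-free same-cluster oracle, learns the hidden partition of $V$ using at most $q_{\mathrm{error\_free}}$ queries in the worst case. Then there is an algorithm which learns the hidden partition of $V$ given access to an $\ell$-faulty same-cluster oracle and always makes at most $(\ell+1)\,q_{\mathrm{error\_free}} + \ell$ queries in the worst case. This holds both when the number $k$ of clusters is unknown and when it is known.
   Context: The same-cluster oracle answers, for a pair of distinct elements of $V$, whether they lie in the same cluster of the hidden partition. An $\ell$-faulty same-cluster oracle may give an incorrect answer on at most $\ell$ of the queries made over the whole run; errors may be adversarial and are not persistent (repeating a query may give different answers). Algorithms may be adaptive. -}

module Defs where

open import Data.Nat using (ℕ; zero; suc; _+_; _*_; _≤_)
open import Data.Nat.Properties using (_≟_)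
open import Data.Fin using (Fin)
open import Data.Bool using (Bool; true; false; not)
open import Data.Product using (Σ; _×_; ∃)
open import Data.Unit using (⊤)
open import Data.Empty using (⊥)
open import Relation.Nullary using (¬_; does)
open import Relation.Binary.PropositionalEquality using (_≡_; _≢_)
open import Function.Bundles using (_⇔_)

-- A hidden partition of V = Fin n is given by a cluster labelling:
-- i and j are in the same cluster iff c i ≡ c j.
Partition : ℕ → Set
Partition n = Fin n → ℕ

sameCluster : ∀ {n} → Partition n → Fin n → Fin n → Bool
sameCluster c i j = does (c i ≟ c j)

Describes : ∀ {n} → Partition n → Partition n → Set
Describes {n} d c = (i j : Fin n) → (d i ≡ d j) ⇔ (c i ≡ c j)

-- A deterministic adaptive query algorithm on V = Fin n (decision tree):
-- either it outputs a partition, or it queries a pair of distinct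
-- elements and continues depending on the (Boolean) answer.
data Alg (n : ℕ) : Set where
  done : Partition n → Alg n
  ask  : (i j : Fin n) → i ≢ j → (Bool → Alg n) → Alg n

-- SolvesWithin A c e q : on hidden partition c, against every oracle that
-- answers incorrectly on at most e of the (remaining) queries, A always
-- outputs the hidden partition and makes at most q queries.
-- (Errors are adversarial, adaptive and non-persistent: every answer may be
--  flipped as long as the error budget allows.)
SolvesWithin : ∀ {n} → Alg n → Partition n → ℕ → ℕ → Set
SolvesWithin (done d) c e q = Describes d c
SolvesWithin (ask i j _ k) c e zero = ⊥
SolvesWithin (ask i j _ k) c e (suc q) =
  SolvesWithin (k (sameCluster c i j)) c e q ×
  LieBranch e
  where
  LieBranch : ℕ → Set
  LieBranch zero = ⊤
  LieBranch (suc e′) = SolvesWithin (k (not (sameCluster c i j))) c e′ q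

HasClusters : ∀ {n} → Partition n → ℕ → Set
HasClusters {n} c k =
  Σ (Fin k → Fin n) λ r →
    ((a b : Fin k) → c (r a) ≡ c (r b) → a ≡ b) ×
    ((i : Fin n) → ∃ λ a → c i ≡ c (r a))

FaultyReduction : (n : ℕ) → (Partition n → Set) → Set
FaultyReduction n P =
  (ℓ q : ℕ) (A : Alg n) →
  ((c : Partition n) → P c → SolvesWithin A c 0 q) →
  Σ (Alg n) λ B →
    (c : Partition n) → P c → SolvesWithin B c ℓ (suc ℓ * q + ℓ)

module Submission where

-- Simulate each query of the error-free algorithm by repeating it until one answer has
-- been received b + 1 times, where b bounds the errors still possible: the oracle cannot
-- produce b + 1 wrong answers, so the winning answer is the true one.  Every losing vote
-- is an error, so the loser's unused count again bounds the remaining errors and is the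
-- budget for the rest of the run.  One query then costs b + 1 truthful answers plus the
-- errors spent on it, which over q queries and at most ℓ errors gives (ℓ + 1) q + ℓ.

open import Defs
open import Data.Nat using (ℕ; zero; suc; _+_; _*_; _≤_; s≤s)
open import Data.Nat.Properties using (≤-refl; ≤-trans; n≤1+n; +-suc; *-suc; +-comm; +-monoʳ-≤; *-monoˡ-≤)
open import Data.Fin using (Fin)
open import Data.Bool using (Bool; true; false; not)
open import Data.Product using (_×_; _,_)
open import Data.Unit using (⊤; tt)
open import Relation.Binary.PropositionalEquality
  using (_≡_; _≢_; refl; sym; cong; subst; module ≡-Reasoning)

SolvesWithin-mono : ∀ {n} (A : Alg n) {c : Partition n} {e q q′ : ℕ} →
  q ≤ q′ → SolvesWithin A c e q → SolvesWithin A c e q′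
SolvesWithin-mono (done d) _ s = s
SolvesWithin-mono (ask i j _ k) {q = zero} _ ()
SolvesWithin-mono (ask i j _ k) {e = zero} {suc q} (s≤s q≤q′) (s , _) =
  SolvesWithin-mono (k _) q≤q′ s , tt
SolvesWithin-mono (ask i j _ k) {e = suc e} {suc q} (s≤s q≤q′) (s , l) =
  SolvesWithin-mono (k _) q≤q′ s , SolvesWithin-mono (k _) q≤q′ l

module Poll {n} (i j : Fin n) (i≢j : i ≢ j) (k : ℕ → Bool → Alg n) where

  -- poll t f asks about {i, j} until true has received t + 1 more votes or false f + 1
  -- more, then continues with k, given the loser's remaining count and the winner.
  -- tally a m o records a vote for a, which still needed m more votes, o being the count
  -- of the other answer.  pollFor τ r w is the same poll with the counts listed relative to
  -- the answer τ: r for τ and w for not τ.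
  poll : ℕ → ℕ → Alg n
  tally : Bool → ℕ → ℕ → Alg n
  poll t f = ask i j i≢j λ { true → tally true t f ; false → tally false f t }
  tally a zero o = k o a
  tally true (suc t) f = poll t f
  tally false (suc f) t = poll t f

  pollFor : Bool → ℕ → ℕ → Alg n
  pollFor true r w = poll r w
  pollFor false r w = poll w r

  pollFor-balanced : ∀ τ b → pollFor τ b b ≡ poll b b
  pollFor-balanced true b = refl
  pollFor-balanced false b = refl

  tally-suc : ∀ τ r w → tally τ (suc r) w ≡ pollFor τ r w
  tally-suc true r w = refl
  tally-suc false r w = refl

  tally-not-suc : ∀ τ r w → tally (not τ) (suc w) r ≡ pollFor τ r w
  tally-not-suc true r w = refl
  tally-not-suc false r w = refl

  pollFor-solves-ask : ∀ {c : Partition n} {e q : ℕ} τ {r w} →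
    sameCluster c i j ≡ τ →
    SolvesWithin (tally τ r w) c e q →
    (∀ {e′} → e ≡ suc e′ → SolvesWithin (tally (not τ) w r) c e′ q) →
    SolvesWithin (pollFor τ r w) c e (suc q)
  pollFor-solves-ask {e = zero} true truth s _ rewrite truth = s , tt
  pollFor-solves-ask {e = suc e} true truth s l rewrite truth = s , l refl
  pollFor-solves-ask {e = zero} false truth s _ rewrite truth = s , tt
  pollFor-solves-ask {e = suc e} false truth s l rewrite truth = s , l refl

  -- τ is the true answer, b bounds the count w of the wrong answer, and R is the cost of
  -- the continuation beyond the errors it has to absorb.
  module Correctness (c : Partition n) (τ : Bool) (truth : sameCluster c i j ≡ τ) (b R : ℕ)
    (k-solves : ∀ {w e} → e ≤ w → w ≤ b → SolvesWithin (k w τ) c e (e + R)) where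

    pollFor-solves : ∀ r {w e} → e ≤ w → w ≤ b → SolvesWithin (pollFor τ r w) c e (suc (e + (r + R)))
    tally-solves : ∀ r {w e} → e ≤ w → w ≤ b → SolvesWithin (tally τ r w) c e (e + (r + R))

    pollFor-solves r e≤w w≤b =
      pollFor-solves-ask τ truth (tally-solves r e≤w w≤b) λ { refl → lie e≤w w≤b }
      where
      lie : ∀ {w e} → suc e ≤ w → w ≤ b → SolvesWithin (tally (not τ) w r) c e (suc (e + (r + R)))
      lie {suc w} (s≤s e≤w) w≤b rewrite tally-not-suc τ r w =
        pollFor-solves r e≤w (≤-trans (n≤1+n w) w≤b)

    tally-solves zero e≤w w≤b = k-solves e≤w w≤b
    tally-solves (suc r) {w} {e} e≤w w≤b rewrite tally-suc τ r w | +-suc e (r + R) =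
      pollFor-solves r e≤w w≤b

simulate : ∀ {n} → ℕ → Alg n → Alg n
simulate b (done d) = done d
simulate b (ask i j i≢j k) = Poll.poll i j i≢j (λ b′ a → simulate b′ (k a)) b b

simulate-solves : ∀ {n} (A : Alg n) {c : Partition n} {q b e : ℕ} →
  SolvesWithin A c 0 q → e ≤ b → SolvesWithin (simulate b A) c e (e + suc b * q)
simulate-solves (done d) s _ = s
simulate-solves (ask i j i≢j k) {c} {suc q} {b} {e} (s , _) e≤b =
  subst (SolvesWithin (simulate b (ask i j i≢j k)) c e) cost
    (subst (λ B → SolvesWithin B c e _) (pollFor-balanced τ b) (pollFor-solves b e≤b ≤-refl))
  where
  open Poll i j i≢j (λ b′ a → simulate b′ (k a))
  τ : Bool
  τ = sameCluster c i j

  continuation-solves : ∀ {w e} → e ≤ w → w ≤ b → SolvesWithin (simulate w (k τ)) c e (e + suc b * q)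
  continuation-solves {w} {e} e≤w w≤b =
    SolvesWithin-mono (simulate w (k τ)) (+-monoʳ-≤ e (*-monoˡ-≤ q (s≤s w≤b))) (simulate-solves (k τ) s e≤w)

  open Correctness c τ refl b (suc b * q) continuation-solves

  cost : suc (e + (b + suc b * q)) ≡ e + suc b * suc q
  cost = begin
    suc (e + (b + suc b * q))  ≡⟨ sym (+-suc e _) ⟩
    e + (suc b + suc b * q)    ≡⟨ cong (e +_) (sym (*-suc (suc b) q)) ⟩
    e + suc b * suc q          ∎
    where open ≡-Reasoning

faultyReduction : ∀ n (P : Partition n → Set) → FaultyReduction n P
faultyReduction n P ℓ q A A-solves =
  simulate ℓ A , λ c Pc →
    subst (SolvesWithin (simulate ℓ A) c ℓ) (+-comm ℓ (suc ℓ * q)) (simulate-solves A (A-solves c Pc) ≤-refl)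

lemma10 : (n : ℕ) →
    FaultyReduction n (λ _ → ⊤) ×
    ((k : ℕ) → FaultyReduction n (λ c → HasClusters c k))
lemma10 n = faultyReduction n _ , λ k → faultyReduction n _
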